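{- Let $E$ be a finite set with a collection of open intervals $\{I_a=(\ell_a,r_a): a\in E\}$, $\ell_a<r_a$, and let $\vartriangleleft$ be the interval order on $E$ defined by $a\vartriangleleft b$ iff $r_a\le \ell_b$. Let $\lessdot$ be the linear ordering of the endpoints $\ell_a,r_a$ ($a\in E$) by position on the real line, with endpoints sharing a position ordered so that all right endpoints precede all left endpoints (otherwise arbitrarily). For a nonempty $\mathcal I\subseteq E$ let $\mathrm{LH}(\mathcal I)$ be the $\lessdot$-smallest element of $\{r_x: x\in\mathcal I\}$ and $\mathrm{UH}(\mathcal I)$ the $\lessdot$-largest element of $\{\ell_x: x\in\mathcal I\}$. For nonempty sets $\mathcal I,\mathcal J\subseteq E$ write $\mathcal I\vartriangleleft\mathcal J$ if there exist $a\in\mathcal I$, $b\in\mathcal J$ with $a\vartriangleleft b$. Let $\mathcal I_1,\dots,\mathcal I_k\subseteq E$ be nonempty, and call $\mathcal I_j$ minimal if there is no $i\ne j$ with $\mathcal I_i\vartriangleleft\mathcal I_j$. Then $\mathcal I_j$ is minimal if and only if there is no $i\ne j$ with $\mathrm{LH}(\mathcal I_i)\lessdot \mathrm{UH}(\mathcal I_j)$.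
   Context: $\mathrm{LH}(\mathcal I)$ and $\mathrm{UH}(\mathcal I)$ are called the lower and upper handles of $\mathcal I$. -}

module Defs where

open import Level using (_⊔_)
open import Data.Nat using (ℕ)
open import Data.Fin using (Fin)
open import Data.Fin.Subset using (Subset; _∈_)
open import Data.Product using (_×_; ∃; ∃-syntax; _,_)
open import Data.Sum using (_⊎_)
open import Relation.Binary.PropositionalEquality using (_≡_; _≢_)
open import Relation.Binary.Bundles using (StrictTotalOrder)
open import Relation.Binary.Structures using (IsStrictTotalOrder)
open import Relation.Nullary using (¬_)

data Side : Set where
  left right : Side

-- the endpoints ℓ_a (a , left) and r_a (a , right), a ∈ E = Fin n
Endpoint : ℕ → Set
Endpoint n = Fin n × Side

module _ {c ℓ₁ ℓ₂} (P : StrictTotalOrder c ℓ₁ ℓ₂) where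
  open StrictTotalOrder P renaming (Carrier to Pos; _<_ to _<P_; _≈_ to _≈P_)

  pos : ∀ {n} → (Fin n → Pos) → (Fin n → Pos) → Endpoint n → Pos
  pos l r (a , left)  = l a
  pos l r (a , right) = r a

  IntervalOrder : ∀ {n} → (Fin n → Pos) → (Fin n → Pos) → Fin n → Fin n → Set (ℓ₁ ⊔ ℓ₂)
  IntervalOrder l r a b = (r a <P l b) ⊎ (r a ≈P l b)

  record IsEndpointOrder {n} (l r : Fin n → Pos)
                         (_⋖_ : Endpoint n → Endpoint n → Set) : Set (c ⊔ ℓ₁ ⊔ ℓ₂) where
    field
      isStrictTotalOrder : IsStrictTotalOrder _≡_ _⋖_
      byPosition : ∀ p q → pos l r p <P pos l r q → p ⋖ q
      rightsFirst : ∀ a b → r a ≈P l b → (a , right) ⋖ (b , left)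

  SetPrec : ∀ {n} → (Fin n → Pos) → (Fin n → Pos) → Subset n → Subset n → Set (ℓ₁ ⊔ ℓ₂)
  SetPrec l r I J = ∃[ a ] ∃[ b ] (a ∈ I × b ∈ J × IntervalOrder l r a b)

  Minimal : ∀ {n k} → (Fin n → Pos) → (Fin n → Pos) → (Fin k → Subset n) → Fin k → Set (ℓ₁ ⊔ ℓ₂)
  Minimal l r I j = ∀ i → i ≢ j → ¬ SetPrec l r (I i) (I j)

-- x ∈ 𝓘 and r_x is the ⋖-smallest of {r_y : y ∈ 𝓘}, i.e. LH(𝓘) = r_x
IsLH : ∀ {n} → (Endpoint n → Endpoint n → Set) → Subset n → Fin n → Set
IsLH _⋖_ I x = x ∈ I × (∀ y → y ∈ I → y ≡ x ⊎ ((x , right) ⋖ (y , right)))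

-- x ∈ 𝓘 and ℓ_x is the ⋖-largest of {ℓ_y : y ∈ 𝓘}, i.e. UH(𝓘) = ℓ_x
IsUH : ∀ {n} → (Endpoint n → Endpoint n → Set) → Subset n → Fin n → Set
IsUH _⋖_ I x = x ∈ I × (∀ y → y ∈ I → y ≡ x ⊎ ((y , left) ⋖ (x , left)))

module Submission where

open import Defs
open import Data.Nat using (ℕ)
open import Data.Fin using (Fin)
open import Data.Fin.Subset using (Subset; Nonempty; _∈_)
open import Data.Product using (∃-syntax; _×_; _,_)
open import Data.Sum using (inj₁; inj₂; [_,_]′)
open import Relation.Binary.PropositionalEquality using (_≢_; refl)
open import Relation.Binary.Bundles using (StrictTotalOrder)
open import Relation.Binary.Structures using (IsStrictTotalOrder)
open import Relation.Binary.Definitions using (Transitive; tri<; tri≈; tri>)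
open import Relation.Nullary using (¬_; contradiction)
open import Function.Bundles using (_⇔_; mk⇔; Equivalence)

-- Because right endpoints precede left ones at equal positions, a ◁ b holds exactly when
-- r_a ⋖ ℓ_b. As r_{LH 𝓘} is ⋖-below every r_a (a ∈ 𝓘) and ℓ_{UH 𝓙} is ⋖-above every
-- ℓ_b (b ∈ 𝓙), transitivity gives 𝓘 ◁ 𝓙 iff LH(𝓘) ⋖ UH(𝓙); minimality is the negation
-- of this for all i ≠ j.

module _ {n} (_⋖_ : Endpoint n → Endpoint n → Set) (⋖-trans : Transitive _⋖_) where

  lh-⋖ : ∀ {I x a e} → IsLH _⋖_ I x → a ∈ I → (a , right) ⋖ e → (x , right) ⋖ e
  lh-⋖ {a = a} (_ , below) a∈I a⋖e with below a a∈I
  ... | inj₁ refl = a⋖e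
  ... | inj₂ x⋖a  = ⋖-trans x⋖a a⋖e

  ⋖-uh : ∀ {J y b e} → IsUH _⋖_ J y → b ∈ J → e ⋖ (b , left) → e ⋖ (y , left)
  ⋖-uh {b = b} (_ , above) b∈J e⋖b with above b b∈J
  ... | inj₁ refl = e⋖b
  ... | inj₂ b⋖y  = ⋖-trans e⋖b b⋖y

module _ {c ℓ₁ ℓ₂} (P : StrictTotalOrder c ℓ₁ ℓ₂) {n} {l r : Fin n → StrictTotalOrder.Carrier P}
         {_⋖_ : Endpoint n → Endpoint n → Set} (order : IsEndpointOrder P l r _⋖_) where

  open IsEndpointOrder order
  open IsStrictTotalOrder isStrictTotalOrder using (trans; asym)
  open StrictTotalOrder P using (compare)

  intervalOrder⇔⋖ : ∀ a b → IntervalOrder P l r a b ⇔ ((a , right) ⋖ (b , left))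
  intervalOrder⇔⋖ a b = mk⇔ to from
    where
    to : IntervalOrder P l r a b → (a , right) ⋖ (b , left)
    to = [ byPosition (a , right) (b , left) , rightsFirst a b ]′
    from : (a , right) ⋖ (b , left) → IntervalOrder P l r a b
    from a⋖b with compare (r a) (l b)
    ... | tri< ra<lb _ _ = inj₁ ra<lb
    ... | tri≈ _ ra≈lb _ = inj₂ ra≈lb
    ... | tri> _ _ lb<ra = contradiction a⋖b (asym (byPosition (b , left) (a , right) lb<ra))

  setPrec⇔handles : ∀ {I J x y} → IsLH _⋖_ I x → IsUH _⋖_ J y →
                    SetPrec P l r I J ⇔ ((x , right) ⋖ (y , left))
  setPrec⇔handles {I} {J} {x} {y} lhI@(x∈I , _) uhJ@(y∈J , _) = mk⇔ to from
    where
    to : SetPrec P l r I J → (x , right) ⋖ (y , left)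
    to (a , b , a∈I , b∈J , a◁b) =
      lh-⋖ _⋖_ trans lhI a∈I (⋖-uh _⋖_ trans uhJ b∈J (Equivalence.to (intervalOrder⇔⋖ a b) a◁b))
    from : (x , right) ⋖ (y , left) → SetPrec P l r I J
    from x⋖y = x , y , x∈I , y∈J , Equivalence.from (intervalOrder⇔⋖ x y) x⋖y

∀≢¬⇔¬∃≢ : ∀ {a p q} {A : Set a} {B : A → Set p} {C : A → Set q} (j : A) →
          (∀ i → B i ⇔ C i) → (∀ i → i ≢ j → ¬ B i) ⇔ (¬ (∃[ i ] (i ≢ j × C i)))
∀≢¬⇔¬∃≢ j B⇔C = mk⇔
  (λ noB (i , i≢j , c) → noB i i≢j (Equivalence.from (B⇔C i) c))
  (λ noC i i≢j b → noC (i , i≢j , Equivalence.to (B⇔C i) b))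

mainTheorem5 : ∀ {c ℓ₁ ℓ₂} (P : StrictTotalOrder c ℓ₁ ℓ₂) (n : ℕ)
    (l r : Fin n → StrictTotalOrder.Carrier P) →
    (∀ a → StrictTotalOrder._<_ P (l a) (r a)) →
    (_⋖_ : Endpoint n → Endpoint n → Set) → IsEndpointOrder P l r _⋖_ →
    (k : ℕ) (I : Fin k → Subset n) → (∀ i → Nonempty (I i)) →
    (lh uh : Fin k → Fin n) →
    (∀ i → IsLH _⋖_ (I i) (lh i)) → (∀ i → IsUH _⋖_ (I i) (uh i)) →
    (j : Fin k) →
    Minimal P l r I j ⇔ (¬ (∃[ i ] (i ≢ j × ((lh i , right) ⋖ (uh j , left)))))
mainTheorem5 P n l r _ _⋖_ order k I _ lh uh isLH isUH j =
  ∀≢¬⇔¬∃≢ j (λ i → setPrec⇔handles P order (isLH i) (isUH j))
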